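{- (Part 1.) Let $\bar y=(m,\bar p,n,F)$ be a weakly separative system. If $L^*$ is a natural number with $L^*\ge 2\,q_{\mathcal P}|F|/q_\emptyset$, then $$\Pr(L_{\mathbf t^*}[\mathcal M^*_n]>L^*)\le\Pr(L_{\mathbf t^*}[\mathcal M^*_n]=L^*).$$
   Context: A system is $\bar y=(m,\bar p,n,F)$ where: $F$ is a family of one-to-one functions from $[m]=\{1,\dots,m\}$ into $[n]=\{1,\dots,n\}$; $\mathcal P$ is a set of nonempty subsets of $[m]$ with an equivalence relation $\mathbf e$ on $\mathcal P$; $\bar p=\langle p_{\mathbf u/\mathbf e}:\mathbf u\in\mathcal P\rangle$ are probabilities, $p_{\mathbf u}:=p_{\mathbf u/\mathbf e}$. Let $R_{\mathbf u}=\{f(\mathbf u):f\in F\}$ and $R_{\mathbf u/\mathbf e}=\bigcup\{R_{\mathbf u'}:\mathbf u'\in\mathbf u/\mathbf e\}$. A random structure $\mathcal M^*_n$ is obtained by choosing, for each class $\mathbf u/\mathbf e$ and each $v\in R_{\mathbf u/\mathbf e}$, independently whether $v\in\mathcal R_{\mathbf u/\mathbf e}$, with probability $p_{\mathbf u/\mathbf e}$; $\Pr$ refers to this distribution. $\bar y$ is weakly separative if there is an equivalence relation $\mathbf e^*$ on $[m]$ such that: (i) no $\mathbf u\in\mathcal P$ contains two distinct $\mathbf e^*$-equivalent elements; (ii) if $\mathbf u_1,\mathbf u_2\in\mathcal P$ meet exactly the same $\mathbf e^*$-classes then $\mathbf u_1\,\mathbf e\,\mathbf u_2$; (iii) there is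 an equivalence relation $\mathbf e'$ on $[n]$ such that for all $f_1,f_2\in F$ and $m_1,m_2\in[m]$: $m_1\,\mathbf e^*\,m_2$ iff $f_1(m_1)\,\mathbf e'\,f_2(m_2)$. $q_\emptyset=\prod_{\mathbf u\in\mathcal P}(1-p_{\mathbf u})$ and $q_{\mathcal P}=\prod_{\mathbf u\in\mathcal P}p_{\mathbf u}$. The graph $G[\mathcal M^*_n]$ has vertex set $\{f\in F: f(\mathbf u)\in\mathcal R_{\mathbf u/\mathbf e}\text{ for every }\mathbf u\in\mathcal P\}$ and edges between distinct $f_1,f_2$ whose ranges intersect. $L_{\mathbf t^*}[\mathcal M^*_n]$ is the number of one-element connected components of $G[\mathcal M^*_n]$.
   Formalization: The probabilities $p_{\mathbf u/\mathbf e}$ are rational numbers in the interval [0,1]. -}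

module Defs where

open import Level using (0ℓ)
open import Data.Bool using (Bool; true; false; if_then_else_; _∧_; _∨_; not)
open import Data.Nat as ℕ using (ℕ; zero; suc)
open import Data.Fin using (Fin)
open import Data.Fin.Properties using () renaming (_≟_ to _≟ᶠ_)
open import Data.Vec using (Vec; []; _∷_; lookup; tabulate)
open import Data.Vec.Properties using (≡-dec)
open import Data.Bool.Properties using () renaming (_≟_ to _≟ᵇ_)
open import Data.List using (List; []; _∷_; map; concatMap; filter; length; allFin; foldr)
open import Data.Bool.ListAction using (any; all)
open import Data.Integer using (+_)
open import Data.Rational using (_/_)
open import Data.List.Relation.Unary.Unique.Propositional using (Unique)
open import Data.List.Membership.Propositional using (_∈_)
open import Data.Product using (Σ; ∃; _×_; _,_; proj₁; proj₂)
open import Data.Rational using (ℚ; 0ℚ; 1ℚ; _+_; _*_; _-_; _≤_)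
open import Relation.Binary using (Rel; IsEquivalence)
open import Relation.Binary.PropositionalEquality using (_≡_; _≢_)
open import Relation.Nullary using (¬_; does)
open import Function using (_⇔_)

ℕ→ℚ : ℕ → ℚ
ℕ→ℚ k = (+ k) / 1

Subset : ℕ → Set
Subset k = Vec Bool k

_∈ˢ_ : ∀ {k} → Fin k → Subset k → Set
i ∈ˢ u = lookup u i ≡ true

allSubsets : (k : ℕ) → List (Subset k)
allSubsets zero = [] ∷ []
allSubsets (suc k) = concatMap (λ v → (false ∷ v) ∷ (true ∷ v) ∷ []) (allSubsets k)

-- A system  y = (m, p̄, n, F)  together with  𝒫  and  e .
-- 𝒫 is given as an injective enumeration  𝒫 : Fin P → Subset m  of nonempty sets;
-- the equivalence relation e on 𝒫 is given by a class map  cls : Fin P → Fin K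
-- (u₁ e u₂ iff cls u₁ ≡ cls u₂), and the probabilities are indexed by classes.
-- One-to-one functions [m] → [n] are represented as vectors  Vec (Fin n) m.
record System : Set where
  field
    m n P K : ℕ
    𝒫      : Fin P → Subset m
    𝒫-inj  : ∀ a b → 𝒫 a ≡ 𝒫 b → a ≡ b
    𝒫-ne   : ∀ a → ∃ λ i → i ∈ˢ 𝒫 a
    cls    : Fin P → Fin K
    prob   : Fin K → ℚ
    prob-lo : ∀ c → 0ℚ ≤ prob c
    prob-hi : ∀ c → prob c ≤ 1ℚ
    F      : List (Vec (Fin n) m)
    F-uniq : Unique F
    F-inj  : ∀ f → f ∈ F → ∀ i j → lookup f i ≡ lookup f j → i ≡ j

module _ (y : System) where
  open System y

  p : Fin P → ℚ
  p a = prob (cls a)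

  image : Vec (Fin n) m → Subset m → Subset n
  image f u = tabulate (λ j → any (λ i → lookup u i ∧ does (lookup f i ≟ᶠ j)) (allFin m))

  -- coordinates of the random structure: pairs (class, v)
  Coord : Set
  Coord = Fin K × Subset n

  _≟ᶜ_ : (a b : Coord) → Bool
  (c , v) ≟ᶜ (c' , v') = does (c ≟ᶠ c') ∧ does (≡-dec _≟ᵇ_ v v')

  -- v ∈ R_{c} where c is an e-class:  v = f(u) for some u with u/e = c and f ∈ F
  inR : Coord → Bool
  inR (c , v) = any (λ a → does (cls a ≟ᶠ c) ∧ any (λ f → does (≡-dec _≟ᵇ_ (image f (𝒫 a)) v)) F) (allFin P)

  coords : List Coord
  coords = filter (λ s → Data.Bool._≟_ (inR s) true)
             (concatMap (λ c → map (λ v → c , v) (allSubsets n)) (allFin K))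

  -- an outcome ω of the random structure: ω (c , v) = true  iff  v ∈ 𝓡_c
  Outcome : Set
  Outcome = Coord → Bool

  update : Outcome → Coord → Bool → Outcome
  update ω s b t = if s ≟ᶜ t then b else ω t

  PrOver : List Coord → Outcome → (Outcome → Bool) → ℚ
  PrOver [] ω E = if E ω then 1ℚ else 0ℚ
  PrOver ((c , v) ∷ ss) ω E =
    prob c * PrOver ss (update ω (c , v) true) E
    + (1ℚ - prob c) * PrOver ss (update ω (c , v) false) E

  Pr : (Outcome → Bool) → ℚ
  Pr E = PrOver coords (λ _ → false) E

  isVertex : Outcome → Vec (Fin n) m → Bool
  isVertex ω f = all (λ a → ω (cls a , image f (𝒫 a))) (allFin P)

  rangesMeet : Vec (Fin n) m → Vec (Fin n) m → Bool
  rangesMeet f g = any (λ i → any (λ j → does (lookup f i ≟ᶠ lookup g j)) (allFin m)) (allFin m)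

  isolated : Outcome → Vec (Fin n) m → Bool
  isolated ω f = isVertex ω f ∧
    all (λ g → does (≡-dec _≟ᶠ_ g f) ∨ not (isVertex ω g) ∨ not (rangesMeet f g)) F

  Lt : Outcome → ℕ
  Lt ω = length (filter (λ f → Data.Bool._≟_ (isolated ω f) true) F)

  prodQ : (Fin P → ℚ) → ℚ
  prodQ g = foldr (λ a r → g a * r) 1ℚ (allFin P)

  qEmpty : ℚ
  qEmpty = prodQ (λ a → 1ℚ - p a)

  qAll : ℚ
  qAll = prodQ p

  WeaklySeparative : Set₁
  WeaklySeparative =
    Σ (Rel (Fin m) 0ℓ) λ e* → IsEquivalence e* ×
      (∀ a i j → i ∈ˢ 𝒫 a → j ∈ˢ 𝒫 a → i ≢ j → ¬ e* i j) ×
      (∀ a b → (∀ i → i ∈ˢ 𝒫 a → ∃ λ j → j ∈ˢ 𝒫 b × e* i j)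
             → (∀ j → j ∈ˢ 𝒫 b → ∃ λ i → i ∈ˢ 𝒫 a × e* j i)
             → cls a ≡ cls b) ×
      (Σ (Rel (Fin n) 0ℓ) λ e' → IsEquivalence e' ×
        (∀ f₁ f₂ → f₁ ∈ F → f₂ ∈ F → ∀ m₁ m₂ →
           e* m₁ m₂ ⇔ e' (lookup f₁ m₁) (lookup f₂ m₂)))

{-# OPTIONS --safe #-}

-- Write Pₖ = Pr(L = k).  Fix f ∈ F and let S be its coordinates (u/e, f(u)), u ∈ 𝒫.  If f is an
-- isolated vertex when every coordinate of S is on, then switching all of S off deletes the
-- vertex f and nothing else: any other g whose vertex status changes shares a coordinate with f,
-- so its range meets that of f, and f being isolated, g was not a vertex.  Since the
-- coordinates are independent, this gives  q∅ · Pr(f isolated ∧ L = k+1) ≤ q𝒫 · Pₖ,  and summing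
-- over f gives  q∅ (k+1) Pₖ₊₁ ≤ |F| q𝒫 Pₖ.  For k ≥ L* ≥ 2 q𝒫 |F| / q∅ this says Pₖ₊₁ ≤ Pₖ / 2,
-- so  Pr(L > L*) = Σ_{k > L*} Pₖ ≤ P_{L*} (1/2 + 1/4 + ⋯) ≤ P_{L*}.

module Submission where

open import Defs
open import Function using (_∘_)
open import Data.Bool using (Bool; true; false; _∧_; _∨_; not; if_then_else_)
open import Data.Bool.Properties using (∨-zeroʳ; ∧-conicalˡ; ∧-conicalʳ; ¬-not; ⇔→≡) renaming (_≟_ to _≟ᵇ_)
open import Data.Bool.ListAction using (all; any; and)
open import Data.Nat as ℕ using (ℕ; zero; suc; z≤n; s≤s)
import Data.Nat.Properties as ℕ
import Data.Integer as ℤ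
import Data.Integer.Solver as ℤ-Solver
open import Data.Rational using (ℚ; 0ℚ; 1ℚ; _+_; _*_; _-_; _÷_; 1/_; -_; _≤_; _<_; NonZero; nonNegative; positive; toℚᵘ)
import Data.Rational.Properties as ℚ
import Data.Rational.Unnormalised as ℚᵘ
import Data.Rational.Unnormalised.Properties as ℚᵘ
open import Data.Rational.Solver using (module +-*-Solver)
open import Data.Product using (∃; ∃₂; _×_; _,_; proj₁; proj₂)
open import Data.Sum using (_⊎_; inj₁; inj₂; [_,_]′)
open import Data.List using (List; []; _∷_; length; filter; foldr; map; allFin)
open import Data.Fin as Fin using (Fin)
open import Data.Fin.Properties using () renaming (_≟_ to _≟ᶠ_)
open import Data.Vec as Vec using (Vec; lookup; tabulate)
open import Data.Vec.Properties using (≡-dec; lookup∘tabulate; tabulate∘lookup; tabulate-cong)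
open import Data.List.Membership.Propositional.Properties using (∈-allFin; ∈-map⁺; ∈-map⁻; ∈-filter⁺; ∈-concatMap⁺)
import Data.List.Relation.Unary.Unique.Propositional.Properties as Unique
open import Data.List.Properties using (length-filter; map-∘; foldr-map)
open import Data.List.Membership.Propositional using (_∈_; _∉_)
open import Data.List.Relation.Unary.Any as Any using (here; there)
open import Data.List.Relation.Unary.All as All using (All)
open import Data.List.Relation.Unary.AllPairs using (_∷_)
open import Data.List.Relation.Unary.Unique.Propositional using (Unique)
open import Relation.Binary.Definitions using (DecidableEquality)
open import Relation.Binary.PropositionalEquality
open import Relation.Nullary using (Dec; does; yes; no; contradiction)
open import Relation.Nullary.Decidable using (dec-true; dec-false)
open import Function.Bundles using (mk⇔)

-- Arithmetic of ℚ

ℕ→ℚ-suc : ∀ k → ℕ→ℚ (suc k) ≡ 1ℚ + ℕ→ℚ k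
ℕ→ℚ-suc k = ℚ.toℚᵘ-injective (begin
  toℚᵘ (ℕ→ℚ (suc k))               ≈⟨ ℚ.toℚᵘ-fromℚᵘ (ℚᵘ.mkℚᵘ (ℤ.+ suc k) 0) ⟩
  ℚᵘ.mkℚᵘ (ℤ.+ suc k) 0            ≈⟨ ℚᵘ.*≡* (solve 1 (λ x → (one :+ x) :* one := (one :* one :+ x :* one) :* one)
                                                     refl (ℤ.+ k)) ⟩
  ℚᵘ.1ℚᵘ ℚᵘ.+ ℚᵘ.mkℚᵘ (ℤ.+ k) 0     ≈⟨ ℚᵘ.+-congʳ ℚᵘ.1ℚᵘ (ℚᵘ.≃-sym (ℚ.toℚᵘ-fromℚᵘ (ℚᵘ.mkℚᵘ (ℤ.+ k) 0))) ⟩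
  toℚᵘ 1ℚ ℚᵘ.+ toℚᵘ (ℕ→ℚ k)         ≈⟨ ℚᵘ.≃-sym (ℚ.toℚᵘ-homo-+ 1ℚ (ℕ→ℚ k)) ⟩
  toℚᵘ (1ℚ + ℕ→ℚ k)                ∎)
  where
  open ℚᵘ.≃-Reasoning
  open ℤ-Solver.+-*-Solver
  one = con (ℤ.+ 1)

ℕ→ℚ-nonNeg : ∀ k → 0ℚ ≤ ℕ→ℚ k
ℕ→ℚ-nonNeg k = ℚ.nonNegative⁻¹ (ℕ→ℚ k) {{ℚ.normalize-nonNeg k 1}}

ℕ→ℚ-mono-≤ : ∀ {a b} → a ℕ.≤ b → ℕ→ℚ a ≤ ℕ→ℚ b
ℕ→ℚ-mono-≤ {zero} {b} z≤n = ℕ→ℚ-nonNeg b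
ℕ→ℚ-mono-≤ {suc a} {suc b} (s≤s a≤b) =
  subst₂ _≤_ (sym (ℕ→ℚ-suc a)) (sym (ℕ→ℚ-suc b)) (ℚ.+-monoʳ-≤ 1ℚ (ℕ→ℚ-mono-≤ a≤b))

ℕ→ℚ-<-suc : ∀ k → ℕ→ℚ k < ℕ→ℚ (suc k)
ℕ→ℚ-<-suc k = subst₂ _<_ (ℚ.+-identityˡ (ℕ→ℚ k)) (sym (ℕ→ℚ-suc k))
  (ℚ.+-monoˡ-< (ℕ→ℚ k) (ℚ.positive⁻¹ 1ℚ))

0<ℕ→ℚ-suc : ∀ k → 0ℚ < ℕ→ℚ (suc k)
0<ℕ→ℚ-suc k = ℚ.≤-<-trans (ℕ→ℚ-nonNeg k) (ℕ→ℚ-<-suc k)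

ℕ→ℚ-cancel-≤ : ∀ {a b} → ℕ→ℚ a ≤ ℕ→ℚ b → a ℕ.≤ b
ℕ→ℚ-cancel-≤ {a} {b} a≤b with a ℕ.≤? b
... | yes a≤b′ = a≤b′
... | no a≰b = contradiction (ℚ.≤-<-trans (ℕ→ℚ-mono-≤ (ℕ.≰⇒> a≰b)) (ℚ.≤-<-trans a≤b (ℕ→ℚ-<-suc b)))
                            (ℚ.<-irrefl refl)

≤-double : ∀ {x} → 0ℚ ≤ x → x ≤ ℕ→ℚ 2 * x
≤-double {x} 0≤x = begin
  x              ≡⟨ ℚ.+-identityʳ x ⟨
  x + 0ℚ         ≤⟨ ℚ.+-monoʳ-≤ x 0≤x ⟩
  x + x          ≡⟨ solve 1 (λ x → x :+ x := (con 1ℚ :+ con 1ℚ) :* x) refl x ⟩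
  ℕ→ℚ 2 * x      ∎
  where
  open ℚ.≤-Reasoning
  open +-*-Solver

0≤1-p : ∀ {p} → p ≤ 1ℚ → 0ℚ ≤ 1ℚ - p
0≤1-p {p} p≤1 = subst (_≤ 1ℚ - p) (ℚ.+-inverseʳ p) (ℚ.+-monoˡ-≤ (- p) p≤1)

*-preserves-0≤ : ∀ {p q} → 0ℚ ≤ p → 0ℚ ≤ q → 0ℚ ≤ p * q
*-preserves-0≤ {p} {q} 0≤p 0≤q =
  ℚ.nonNegative⁻¹ (p * q) {{ℚ.nonNeg*nonNeg⇒nonNeg p {{nonNegative 0≤p}} q {{nonNegative 0≤q}}}}

*-monoˡ-≤-0≤ : ∀ {r p q} → 0ℚ ≤ r → p ≤ q → r * p ≤ r * q
*-monoˡ-≤-0≤ {r} 0≤r = ℚ.*-monoˡ-≤-nonNeg r {{nonNegative 0≤r}}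

*-monoʳ-≤-0≤ : ∀ {r p q} → 0ℚ ≤ r → p ≤ q → p * r ≤ q * r
*-monoʳ-≤-0≤ {r} 0≤r = ℚ.*-monoʳ-≤-nonNeg r {{nonNegative 0≤r}}

÷-≤⇒≤-* : ∀ {p q r} .{{_ : NonZero q}} → 0ℚ ≤ q → p ÷ q ≤ r → p ≤ r * q
÷-≤⇒≤-* {p} {q} {r} 0≤q p÷q≤r = subst (_≤ r * q) p÷q*q≡p (*-monoʳ-≤-0≤ 0≤q p÷q≤r)
  where
  p÷q*q≡p : p ÷ q * q ≡ p
  p÷q*q≡p = trans (ℚ.*-assoc p (1/ q) q) (trans (cong (p *_) (ℚ.*-inverseˡ q)) (ℚ.*-identityʳ p))

-- Indicators, finite sums, products and counts

𝟙 : Bool → ℚ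
𝟙 true = 1ℚ
𝟙 false = 0ℚ

𝟙-nonNeg : ∀ b → 0ℚ ≤ 𝟙 b
𝟙-nonNeg true = ℚ.<⇒≤ (ℚ.positive⁻¹ 1ℚ)
𝟙-nonNeg false = ℚ.≤-refl

𝟙-∧ : ∀ a b → 𝟙 (a ∧ b) ≡ 𝟙 a * 𝟙 b
𝟙-∧ true b = sym (ℚ.*-identityˡ (𝟙 b))
𝟙-∧ false b = sym (ℚ.*-zeroˡ (𝟙 b))

𝟙-*-≤ : ∀ b {x} → 0ℚ ≤ x → 𝟙 b * x ≤ x
𝟙-*-≤ true {x} _ = ℚ.≤-reflexive (ℚ.*-identityˡ x)
𝟙-*-≤ false {x} 0≤x = subst (_≤ x) (sym (ℚ.*-zeroˡ x)) 0≤x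

module _ {A : Set} where

  ∑ : (A → ℚ) → List A → ℚ
  ∑ a [] = 0ℚ
  ∑ a (x ∷ xs) = a x + ∑ a xs

  ∏ : (A → ℚ) → List A → ℚ
  ∏ a = foldr (λ x r → a x * r) 1ℚ

  ∑-*ˡ : ∀ c a xs → ∑ (λ x → c * a x) xs ≡ c * ∑ a xs
  ∑-*ˡ c a [] = sym (ℚ.*-zeroʳ c)
  ∑-*ˡ c a (x ∷ xs) = trans (cong (c * a x +_) (∑-*ˡ c a xs)) (sym (ℚ.*-distribˡ-+ c (a x) (∑ a xs)))

  ∑-*ʳ : ∀ c a xs → ∑ (λ x → a x * c) xs ≡ ∑ a xs * c
  ∑-*ʳ c a [] = sym (ℚ.*-zeroˡ c)
  ∑-*ʳ c a (x ∷ xs) = trans (cong (a x * c +_) (∑-*ʳ c a xs)) (sym (ℚ.*-distribʳ-+ c (a x) (∑ a xs)))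

  ∑-mono-≤ : ∀ {a b} xs → (∀ x → x ∈ xs → a x ≤ b x) → ∑ a xs ≤ ∑ b xs
  ∑-mono-≤ [] _ = ℚ.≤-refl
  ∑-mono-≤ (x ∷ xs) a≤b = ℚ.+-mono-≤ (a≤b x (here refl)) (∑-mono-≤ xs (λ z z∈xs → a≤b z (there z∈xs)))

  ∑-const : ∀ c xs → ∑ (λ _ → c) xs ≡ ℕ→ℚ (length xs) * c
  ∑-const c [] = sym (ℚ.*-zeroˡ c)
  ∑-const c (x ∷ xs) = begin
    c + ∑ (λ _ → c) xs              ≡⟨ cong (c +_) (∑-const c xs) ⟩
    c + ℕ→ℚ (length xs) * c         ≡⟨ solve 2 (λ c n → c :+ n :* c := (con 1ℚ :+ n) :* c) refl c (ℕ→ℚ (length xs)) ⟩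
    (1ℚ + ℕ→ℚ (length xs)) * c      ≡⟨ cong (_* c) (sym (ℕ→ℚ-suc (length xs))) ⟩
    ℕ→ℚ (length (x ∷ xs)) * c       ∎
    where
    open ≡-Reasoning
    open +-*-Solver

  ∏-nonNeg : ∀ {a} xs → (∀ x → 0ℚ ≤ a x) → 0ℚ ≤ ∏ a xs
  ∏-nonNeg [] _ = ℚ.<⇒≤ (ℚ.positive⁻¹ 1ℚ)
  ∏-nonNeg (x ∷ xs) 0≤a = *-preserves-0≤ (0≤a x) (∏-nonNeg xs 0≤a)

  count : (A → Bool) → List A → ℕ
  count q xs = length (filter (λ x → q x ≟ᵇ true) xs)

  count-≤-length : ∀ q xs → count q xs ℕ.≤ length xs
  count-≤-length q = length-filter (λ x → q x ≟ᵇ true)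

  count-cong : ∀ {q q′} xs → (∀ x → x ∈ xs → q x ≡ q′ x) → count q xs ≡ count q′ xs
  count-cong [] _ = refl
  count-cong {q} {q′} (x ∷ xs) q≡q′ with q x | q′ x | q≡q′ x (here refl)
  ... | true  | .true  | refl = cong suc (count-cong xs (λ z z∈xs → q≡q′ z (there z∈xs)))
  ... | false | .false | refl = count-cong xs (λ z z∈xs → q≡q′ z (there z∈xs))

  count-toggle : ∀ {q q′ x} xs → Unique xs → x ∈ xs →
    (∀ z → z ∈ xs → z ≢ x → q z ≡ q′ z) → q x ≡ false → q′ x ≡ true →
    count q′ xs ≡ suc (count q xs)
  count-toggle {q} {q′} (x ∷ xs) (x∉xs ∷ _) (here refl) q≡q′ qx qx′ rewrite qx | qx′ =
    cong suc (sym (count-cong xs (λ z z∈xs → q≡q′ z (there z∈xs) (λ { refl → All.lookup x∉xs z∈xs refl }))))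
  count-toggle {q} {q′} (z ∷ xs) (z≢ ∷ uniq) (there x∈xs) q≡q′ qx qx′
    with q z | q′ z | q≡q′ z (here refl) (All.lookup z≢ x∈xs)
  ... | true  | .true  | refl = cong suc (count-toggle xs uniq x∈xs (λ w w∈xs → q≡q′ w (there w∈xs)) qx qx′)
  ... | false | .false | refl = count-toggle xs uniq x∈xs (λ w w∈xs → q≡q′ w (there w∈xs)) qx qx′

  count-as-∑ : ∀ q xs → ℕ→ℚ (count q xs) ≡ ∑ (𝟙 ∘ q) xs
  count-as-∑ q [] = refl
  count-as-∑ q (x ∷ xs) with q x
  ... | true  = trans (ℕ→ℚ-suc (count q xs)) (cong (1ℚ +_) (count-as-∑ q xs))
  ... | false = trans (count-as-∑ q xs) (sym (ℚ.+-identityˡ _))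

  any-true⁺ : ∀ (p : A → Bool) {x xs} → x ∈ xs → p x ≡ true → any p xs ≡ true
  any-true⁺ p (here refl) px rewrite px = refl
  any-true⁺ p {xs = z ∷ _} (there x∈xs) px with p z
  ... | true  = refl
  ... | false = any-true⁺ p x∈xs px

  any-true⁻ : ∀ (p : A → Bool) xs → any p xs ≡ true → ∃ λ x → p x ≡ true
  any-true⁻ p (x ∷ xs) any≡true with p x in px
  ... | true  = x , px
  ... | false = any-true⁻ p xs any≡true

  all-true⁻ : ∀ (p : A → Bool) {x xs} → all p xs ≡ true → x ∈ xs → p x ≡ true
  all-true⁻ p {xs = z ∷ _} all≡true (here refl) = ∧-conicalˡ (p z) _ all≡true
  all-true⁻ p {xs = z ∷ _} all≡true (there x∈xs) = all-true⁻ p (∧-conicalʳ (p z) _ all≡true) x∈xs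

  all-cong : ∀ {p q : A → Bool} xs → (∀ x → x ∈ xs → p x ≡ q x) → all p xs ≡ all q xs
  all-cong [] _ = refl
  all-cong (x ∷ xs) p≡q = cong₂ _∧_ (p≡q x (here refl)) (all-cong xs (λ z z∈xs → p≡q z (there z∈xs)))

  all-mono : ∀ {p q : A → Bool} xs → (∀ x → p x ≡ true → q x ≡ true) → all p xs ≡ true → all q xs ≡ true
  all-mono [] _ _ = refl
  all-mono {p} (x ∷ xs) p⇒q all≡true =
    cong₂ _∧_ (p⇒q x (∧-conicalˡ (p x) _ all≡true)) (all-mono xs p⇒q (∧-conicalʳ (p x) _ all≡true))

zero⊎Fin : ∀ k → k ≡ 0 ⊎ Fin k
zero⊎Fin zero = inj₁ refl
zero⊎Fin (suc k) = inj₂ Fin.zero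

∏-allFin-zero : ∀ {k} (g : Fin k → ℚ) → k ≡ 0 → ∏ g (allFin k) ≡ 1ℚ
∏-allFin-zero g refl = refl

_≡ᵇ_ : Bool → Bool → Bool
x ≡ᵇ true = x
x ≡ᵇ false = not x

-- Independent Bernoulli coordinates

-- 𝔼 ss ω X is the expectation of X when the coordinates in ss are independent, s being true with
-- probability p s, and every other coordinate is fixed as in ω.  Repetitions in ss are harmless,
-- which matters since coords y is not known to be duplicate-free.  The equality test is Boolean
-- so that ω [ s ≔ b ] is definitionally Defs.update.
module Bernoulli {C : Set} (_==_ : C → C → Bool)
                 (==-refl : ∀ s → (s == s) ≡ true) (==-sound : ∀ {s t} → (s == t) ≡ true → s ≡ t)
                 (p : C → ℚ) (0≤p : ∀ s → 0ℚ ≤ p s) (p≤1 : ∀ s → p s ≤ 1ℚ) where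

  _≟_ : DecidableEquality C
  s ≟ t with s == t in s==t
  ... | true  = yes (==-sound s==t)
  ... | false = no (λ { refl → contradiction (trans (sym (==-refl s)) s==t) λ () })

  open import Data.List.Membership.DecPropositional _≟_ using (_∈?_)

  Ω : Set
  Ω = C → Bool

  Extensional : (Ω → ℚ) → Set
  Extensional X = ∀ {ω ω′} → ω ≗ ω′ → X ω ≡ X ω′

  _[_≔_] : Ω → C → Bool → Ω
  (ω [ s ≔ b ]) t = if s == t then b else ω t

  set-same : ∀ ω s b → (ω [ s ≔ b ]) s ≡ b
  set-same ω s b rewrite ==-refl s = refl

  set-other : ∀ ω {s t} b → s ≢ t → (ω [ s ≔ b ]) t ≡ ω t
  set-other ω {s} {t} b s≢t with s == t in s==t
  ... | true  = contradiction (==-sound s==t) s≢t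
  ... | false = refl

  set-cong : ∀ {ω ω′} s b → ω ≗ ω′ → ω [ s ≔ b ] ≗ ω′ [ s ≔ b ]
  set-cong s b ω≗ω′ t = cong (if s == t then b else_) (ω≗ω′ t)

  set-idem : ∀ ω s a b → ω [ s ≔ a ] [ s ≔ b ] ≗ ω [ s ≔ b ]
  set-idem ω s a b t with s == t
  ... | true  = refl
  ... | false = refl

  set-comm : ∀ ω {s t} a b → s ≢ t → ω [ t ≔ a ] [ s ≔ b ] ≗ ω [ s ≔ b ] [ t ≔ a ]
  set-comm ω {s} {t} a b s≢t u with s == u in s==u | t == u in t==u
  ... | true  | true  = contradiction (trans (==-sound s==u) (sym (==-sound t==u))) s≢t
  ... | true  | false = refl
  ... | false | true  = refl
  ... | false | false = refl

  bern : C → Bool → ℚ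
  bern s true = p s
  bern s false = 1ℚ - p s

  mix : C → ℚ → ℚ → ℚ
  mix s a b = p s * a + (1ℚ - p s) * b

  𝔼 : List C → Ω → (Ω → ℚ) → ℚ
  𝔼 [] ω X = X ω
  𝔼 (s ∷ ss) ω X = mix s (𝔼 ss (ω [ s ≔ true ]) X) (𝔼 ss (ω [ s ≔ false ]) X)

  module _ where
    open +-*-Solver

    mix-+ : ∀ s a b a′ b′ → mix s (a + a′) (b + b′) ≡ mix s a b + mix s a′ b′
    mix-+ s = solve 5 (λ p a b a′ b′ → p :* (a :+ a′) :+ (con 1ℚ :- p) :* (b :+ b′)
                          := (p :* a :+ (con 1ℚ :- p) :* b) :+ (p :* a′ :+ (con 1ℚ :- p) :* b′)) refl (p s)

    mix-*ˡ : ∀ s c a b → mix s (c * a) (c * b) ≡ c * mix s a b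
    mix-*ˡ s = solve 4 (λ p c a b → p :* (c :* a) :+ (con 1ℚ :- p) :* (c :* b)
                          := c :* (p :* a :+ (con 1ℚ :- p) :* b)) refl (p s)

    mix-const : ∀ s a → mix s a a ≡ a
    mix-const s = solve 2 (λ p a → p :* a :+ (con 1ℚ :- p) :* a := a) refl (p s)

    mix-𝟙 : ∀ s b a₁ a₀ → mix s (𝟙 (true ≡ᵇ b) * a₁) (𝟙 (false ≡ᵇ b) * a₀) ≡ bern s b * (if b then a₁ else a₀)
    mix-𝟙 s true = solve 3 (λ p a₁ a₀ → p :* (con 1ℚ :* a₁) :+ (con 1ℚ :- p) :* (con 0ℚ :* a₀) := p :* a₁) refl (p s)
    mix-𝟙 s false = solve 3 (λ p a₁ a₀ → p :* (con 0ℚ :* a₁) :+ (con 1ℚ :- p) :* (con 1ℚ :* a₀)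
                                 := (con 1ℚ :- p) :* a₀) refl (p s)

  mix-mono-≤ : ∀ s {a b a′ b′} → a ≤ a′ → b ≤ b′ → mix s a b ≤ mix s a′ b′
  mix-mono-≤ s a≤a′ b≤b′ = ℚ.+-mono-≤ (*-monoˡ-≤-0≤ (0≤p s) a≤a′) (*-monoˡ-≤-0≤ (0≤1-p (p≤1 s)) b≤b′)

  𝔼-cong : ∀ ss ω {X Y} → (∀ ω → X ω ≡ Y ω) → 𝔼 ss ω X ≡ 𝔼 ss ω Y
  𝔼-cong [] ω X≡Y = X≡Y ω
  𝔼-cong (s ∷ ss) ω X≡Y = cong₂ (mix s) (𝔼-cong ss _ X≡Y) (𝔼-cong ss _ X≡Y)

  𝔼-congω : ∀ ss {ω ω′} X → Extensional X → ω ≗ ω′ → 𝔼 ss ω X ≡ 𝔼 ss ω′ X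
  𝔼-congω [] X ext ω≗ω′ = ext ω≗ω′
  𝔼-congω (s ∷ ss) X ext ω≗ω′ =
    cong₂ (mix s) (𝔼-congω ss X ext (set-cong s true ω≗ω′)) (𝔼-congω ss X ext (set-cong s false ω≗ω′))

  𝔼-+ : ∀ ss ω X Y → 𝔼 ss ω (λ ω → X ω + Y ω) ≡ 𝔼 ss ω X + 𝔼 ss ω Y
  𝔼-+ [] ω X Y = refl
  𝔼-+ (s ∷ ss) ω X Y = trans (cong₂ (mix s) (𝔼-+ ss _ X Y) (𝔼-+ ss _ X Y)) (mix-+ s _ _ _ _)

  𝔼-*ˡ : ∀ ss ω c X → 𝔼 ss ω (λ ω → c * X ω) ≡ c * 𝔼 ss ω X
  𝔼-*ˡ [] ω c X = refl
  𝔼-*ˡ (s ∷ ss) ω c X = trans (cong₂ (mix s) (𝔼-*ˡ ss _ c X) (𝔼-*ˡ ss _ c X)) (mix-*ˡ s c _ _)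

  𝔼-const : ∀ ss ω c → 𝔼 ss ω (λ _ → c) ≡ c
  𝔼-const [] ω c = refl
  𝔼-const (s ∷ ss) ω c = trans (cong₂ (mix s) (𝔼-const ss _ c) (𝔼-const ss _ c)) (mix-const s c)

  𝔼-mono-≤ : ∀ ss ω {X Y} → (∀ ω → X ω ≤ Y ω) → 𝔼 ss ω X ≤ 𝔼 ss ω Y
  𝔼-mono-≤ [] ω X≤Y = X≤Y ω
  𝔼-mono-≤ (s ∷ ss) ω X≤Y = mix-mono-≤ s (𝔼-mono-≤ ss _ X≤Y) (𝔼-mono-≤ ss _ X≤Y)

  𝔼-nonNeg : ∀ ss ω {X} → (∀ ω → 0ℚ ≤ X ω) → 0ℚ ≤ 𝔼 ss ω X
  𝔼-nonNeg ss ω 0≤X = subst (_≤ 𝔼 ss ω _) (𝔼-const ss ω 0ℚ) (𝔼-mono-≤ ss ω 0≤X)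

  𝔼-∑ : ∀ {A : Set} ss ω (X : A → Ω → ℚ) xs → 𝔼 ss ω (λ ω → ∑ (λ x → X x ω) xs) ≡ ∑ (λ x → 𝔼 ss ω (X x)) xs
  𝔼-∑ ss ω X [] = 𝔼-const ss ω 0ℚ
  𝔼-∑ ss ω X (x ∷ xs) = trans (𝔼-+ ss ω (X x) _) (cong (𝔼 ss ω (X x) +_) (𝔼-∑ ss ω X xs))

  𝔼-*-∉ : ∀ ss ω {s} (g : Bool → ℚ) X → s ∉ ss → 𝔼 ss ω (λ ω → g (ω s) * X ω) ≡ g (ω s) * 𝔼 ss ω X
  𝔼-*-∉ [] ω g X s∉ss = refl
  𝔼-*-∉ (t ∷ ss) ω g X s∉ss
    rewrite 𝔼-*-∉ ss (ω [ t ≔ true ]) g X (s∉ss ∘ there)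
          | 𝔼-*-∉ ss (ω [ t ≔ false ]) g X (s∉ss ∘ there)
          | set-other ω true (λ t≡s → s∉ss (here (sym t≡s)))
          | set-other ω false (λ t≡s → s∉ss (here (sym t≡s))) = mix-*ˡ t (g (ω _)) _ _

  𝔼-set-∉ : ∀ ss ω {s} b X → s ∉ ss → Extensional X → 𝔼 ss ω (λ ω → X (ω [ s ≔ b ])) ≡ 𝔼 ss (ω [ s ≔ b ]) X
  𝔼-set-∉ [] ω b X s∉ss ext = refl
  𝔼-set-∉ (t ∷ ss) ω b X s∉ss ext = cong₂ (mix t) (commute true) (commute false)
    where
    commute : ∀ a → 𝔼 ss (ω [ t ≔ a ]) (λ ω → X (ω [ _ ≔ b ])) ≡ 𝔼 ss (ω [ _ ≔ b ] [ t ≔ a ]) X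
    commute a = trans (𝔼-set-∉ ss _ b X (s∉ss ∘ there) ext)
                      (𝔼-congω ss X ext (set-comm ω a b (s∉ss ∘ here)))

  𝔼-factor₁ : ∀ ss ω {s} b X → s ∈ ss → Extensional X →
    𝔼 ss ω (λ ω → 𝟙 (ω s ≡ᵇ b) * X ω) ≡ bern s b * 𝔼 ss ω (λ ω → X (ω [ s ≔ b ]))
  𝔼-factor₁ (t ∷ ss) ω {s} b X s∈t∷ss ext with s ∈? ss
  ... | yes s∈ss = trans (cong₂ (mix t) (𝔼-factor₁ ss _ b X s∈ss ext) (𝔼-factor₁ ss _ b X s∈ss ext))
                         (mix-*ˡ t (bern s b) _ _)
  ... | no s∉ss with s∈t∷ss
  ...   | there s∈ss = contradiction s∈ss s∉ss
  ...   | here refl = begin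
    mix s (𝔼 ss (ω [ s ≔ true ]) (λ ω → 𝟙 (ω s ≡ᵇ b) * X ω)) (𝔼 ss (ω [ s ≔ false ]) (λ ω → 𝟙 (ω s ≡ᵇ b) * X ω))
      ≡⟨ cong₂ (mix s) (pullOut true) (pullOut false) ⟩
    mix s (𝟙 (true ≡ᵇ b) * 𝔼 ss (ω [ s ≔ true ]) X) (𝟙 (false ≡ᵇ b) * 𝔼 ss (ω [ s ≔ false ]) X)
      ≡⟨ mix-𝟙 s b _ _ ⟩
    bern s b * (if b then 𝔼 ss (ω [ s ≔ true ]) X else 𝔼 ss (ω [ s ≔ false ]) X)
      ≡⟨ cong (bern s b *_) (chosen b) ⟩
    bern s b * 𝔼 ss (ω [ s ≔ b ]) X
      ≡⟨ cong (bern s b *_) (sym (mix-const s _)) ⟩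
    bern s b * mix s (𝔼 ss (ω [ s ≔ b ]) X) (𝔼 ss (ω [ s ≔ b ]) X)
      ≡⟨ cong (bern s b *_) (cong₂ (mix s) (sym (overwrite true)) (sym (overwrite false))) ⟩
    bern s b * mix s (𝔼 ss (ω [ s ≔ true ]) (λ ω → X (ω [ s ≔ b ]))) (𝔼 ss (ω [ s ≔ false ]) (λ ω → X (ω [ s ≔ b ]))) ∎
    where
    open ≡-Reasoning
    pullOut : ∀ a → 𝔼 ss (ω [ s ≔ a ]) (λ ω → 𝟙 (ω s ≡ᵇ b) * X ω) ≡ 𝟙 (a ≡ᵇ b) * 𝔼 ss (ω [ s ≔ a ]) X
    pullOut a = trans (𝔼-*-∉ ss _ (λ x → 𝟙 (x ≡ᵇ b)) X s∉ss)
                      (cong (λ x → 𝟙 (x ≡ᵇ b) * 𝔼 ss (ω [ s ≔ a ]) X) (set-same ω s a))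
    chosen : ∀ b → (if b then 𝔼 ss (ω [ s ≔ true ]) X else 𝔼 ss (ω [ s ≔ false ]) X) ≡ 𝔼 ss (ω [ s ≔ b ]) X
    chosen true = refl
    chosen false = refl
    overwrite : ∀ a → 𝔼 ss (ω [ s ≔ a ]) (λ ω → X (ω [ s ≔ b ])) ≡ 𝔼 ss (ω [ s ≔ b ]) X
    overwrite a = trans (𝔼-set-∉ ss _ b X s∉ss ext) (𝔼-congω ss X ext (set-idem ω s a b))

  setAll : List C → Bool → Ω → Ω
  setAll S b ω = foldr (λ s ω → ω [ s ≔ b ]) ω S

  setAll-∈ : ∀ S b ω {t} → t ∈ S → setAll S b ω t ≡ b
  setAll-∈ (s ∷ S) b ω (here refl) = set-same (setAll S b ω) s b
  setAll-∈ (s ∷ S) b ω {t} (there t∈S) with s ≟ t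
  ... | yes refl = set-same (setAll S b ω) s b
  ... | no s≢t = trans (set-other (setAll S b ω) b s≢t) (setAll-∈ S b ω t∈S)

  setAll-∉ : ∀ S b ω {t} → t ∉ S → setAll S b ω t ≡ ω t
  setAll-∉ [] b ω t∉S = refl
  setAll-∉ (s ∷ S) b ω t∉S =
    trans (set-other (setAll S b ω) b (λ s≡t → t∉S (here (sym s≡t)))) (setAll-∉ S b ω (t∉S ∘ there))

  setAll-false⊑true : ∀ S ω t → setAll S false ω t ≡ true → setAll S true ω t ≡ true
  setAll-false⊑true [] ω t ω≡true = ω≡true
  setAll-false⊑true (s ∷ S) ω t set≡true with s == t
  ... | true  = refl
  ... | false = setAll-false⊑true S ω t set≡true

  constantOn : List C → Bool → Ω → Bool
  constantOn S b ω = all (λ s → ω s ≡ᵇ b) S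

  constantOn-cong : ∀ S b {ω ω′} → ω ≗ ω′ → constantOn S b ω ≡ constantOn S b ω′
  constantOn-cong S b ω≗ω′ = all-cong S (λ t _ → cong (_≡ᵇ b) (ω≗ω′ t))

  constantOn-set : ∀ S b ω {s} a → All (s ≢_) S → constantOn S b (ω [ s ≔ a ]) ≡ constantOn S b ω
  constantOn-set S b ω a s∉S = all-cong S (λ t t∈S → cong (_≡ᵇ b) (set-other ω a (All.lookup s∉S t∈S)))

  𝔼-factor : ∀ ss ω S b X → (∀ {t} → t ∈ S → t ∈ ss) → Unique S → Extensional X →
    𝔼 ss ω (λ ω → 𝟙 (constantOn S b ω) * X ω) ≡ ∏ (λ s → bern s b) S * 𝔼 ss ω (X ∘ setAll S b)
  𝔼-factor ss ω [] b X _ _ _ = trans (𝔼-cong ss ω (λ ω → ℚ.*-identityˡ (X ω))) (sym (ℚ.*-identityˡ _))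
  𝔼-factor ss ω (s ∷ S) b X S⊆ss (s∉S ∷ uniq) ext = begin
    𝔼 ss ω (λ ω → 𝟙 (constantOn (s ∷ S) b ω) * X ω)
      ≡⟨ 𝔼-cong ss ω (λ ω → trans (cong (_* X ω) (𝟙-∧ (ω s ≡ᵇ b) _))
                                  (ℚ.*-assoc (𝟙 (ω s ≡ᵇ b)) (𝟙 (constantOn S b ω)) (X ω))) ⟩
    𝔼 ss ω (λ ω → 𝟙 (ω s ≡ᵇ b) * X′ ω)
      ≡⟨ 𝔼-factor₁ ss ω b X′ (S⊆ss (here refl)) ext′ ⟩
    bern s b * 𝔼 ss ω (λ ω → X′ (ω [ s ≔ b ]))
      ≡⟨ cong (bern s b *_) (𝔼-cong ss ω (λ ω → cong (λ c → 𝟙 c * X (ω [ s ≔ b ])) (constantOn-set S b ω b s∉S))) ⟩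
    bern s b * 𝔼 ss ω (λ ω → 𝟙 (constantOn S b ω) * X (ω [ s ≔ b ]))
      ≡⟨ cong (bern s b *_) (𝔼-factor ss ω S b (λ ω → X (ω [ s ≔ b ])) (S⊆ss ∘ there) uniq (ext ∘ set-cong s b)) ⟩
    bern s b * (∏ (λ s → bern s b) S * 𝔼 ss ω (X ∘ setAll (s ∷ S) b))
      ≡⟨ sym (ℚ.*-assoc (bern s b) (∏ (λ s → bern s b) S) (𝔼 ss ω (X ∘ setAll (s ∷ S) b))) ⟩
    ∏ (λ s → bern s b) (s ∷ S) * 𝔼 ss ω (X ∘ setAll (s ∷ S) b) ∎
    where
    open ≡-Reasoning
    X′ : Ω → ℚ
    X′ ω = 𝟙 (constantOn S b ω) * X ω
    ext′ : Extensional X′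
    ext′ ω≗ω′ = cong₂ _*_ (cong 𝟙 (constantOn-cong S b ω≗ω′)) (ext ω≗ω′)

-- The tail estimate

-- t k stands for Σ_{j > k} a j.
tail≤head : (a t : ℕ → ℚ) (L N : ℕ) →
  (∀ k → t k ≡ a (suc k) + t (suc k)) → (∀ k → N ℕ.≤ k → t k ≡ 0ℚ) → (∀ k → 0ℚ ≤ a k) →
  (∀ k → L ℕ.≤ k → a (suc k) + a (suc k) ≤ a k) → t L ≤ a L
tail≤head a t L N t-step t-vanishes 0≤a halving = bound N L ℕ.≤-refl (ℕ.m≤n+m N L)
  where
  bound : ∀ j k → L ℕ.≤ k → N ℕ.≤ k ℕ.+ j → t k ≤ a k
  bound zero k _ N≤k+0 = subst (_≤ a k) (sym (t-vanishes k (subst (N ℕ.≤_) (ℕ.+-identityʳ k) N≤k+0))) (0≤a k)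
  bound (suc j) k L≤k N≤k+1+j = begin
    t k                         ≡⟨ t-step k ⟩
    a (suc k) + t (suc k)       ≤⟨ ℚ.+-monoʳ-≤ (a (suc k)) (bound j (suc k) (ℕ.m≤n⇒m≤1+n L≤k) N≤1+k+j) ⟩
    a (suc k) + a (suc k)       ≤⟨ halving k L≤k ⟩
    a k                         ∎
    where
    open ℚ.≤-Reasoning
    N≤1+k+j : N ℕ.≤ suc k ℕ.+ j
    N≤1+k+j = subst (N ℕ.≤_) (ℕ.+-suc k j) N≤k+1+j

halving-of-recurrence : ∀ {e a n l κ p q} → 0ℚ < e → 0ℚ < κ → 0ℚ ≤ q →
  e * (κ * p) ≤ n * (a * q) → ℕ→ℚ 2 * a * n ≤ l * e → l ≤ κ → p + p ≤ q
halving-of-recurrence {e} {a} {n} {l} {κ} {p} {q} 0<e 0<κ 0≤q recurrence 2an≤le l≤κ =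
  ℚ.*-cancelˡ-≤-pos (e * κ) {{ℚ.pos*pos⇒pos e {{positive 0<e}} κ {{positive 0<κ}}}} (begin
    e * κ * (p + p)          ≡⟨ solve 3 (λ e κ p → e :* κ :* (p :+ p) := two :* (e :* (κ :* p))) refl e κ p ⟩
    ℕ→ℚ 2 * (e * (κ * p))    ≤⟨ *-monoˡ-≤-0≤ (ℕ→ℚ-nonNeg 2) recurrence ⟩
    ℕ→ℚ 2 * (n * (a * q))    ≡⟨ solve 3 (λ n a q → two :* (n :* (a :* q)) := two :* a :* n :* q) refl n a q ⟩
    ℕ→ℚ 2 * a * n * q        ≤⟨ *-monoʳ-≤-0≤ 0≤q 2an≤le ⟩
    l * e * q                ≤⟨ *-monoʳ-≤-0≤ 0≤q (*-monoʳ-≤-0≤ (ℚ.<⇒≤ 0<e) l≤κ) ⟩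
    κ * e * q                ≡⟨ cong (_* q) (ℚ.*-comm κ e) ⟩
    e * κ * q                ∎)
  where
  open ℚ.≤-Reasoning
  open +-*-Solver
  two = con 1ℚ :+ con 1ℚ

-- The random graph G[M*]

module RandomGraph (y : System) where
  open System y

  Map : Set
  Map = Vec (Fin n) m

  ∈-image⁺ : ∀ (f : Map) u {i} → i ∈ˢ u → lookup f i ∈ˢ image y f u
  ∈-image⁺ f u {i} i∈u = trans (lookup∘tabulate _ (lookup f i))
    (any-true⁺ (λ i′ → lookup u i′ ∧ does (lookup f i′ ≟ᶠ lookup f i)) (∈-allFin i)
      (cong₂ _∧_ i∈u (dec-true (lookup f i ≟ᶠ lookup f i) refl)))

  ∈-image⁻ : ∀ (f : Map) u {j} → j ∈ˢ image y f u → ∃ λ i → i ∈ˢ u × lookup f i ≡ j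
  ∈-image⁻ f u {j} j∈fu
    with i , i∈u∧fi≡j ← any-true⁻ (λ i → lookup u i ∧ does (lookup f i ≟ᶠ j)) (allFin m)
                                   (trans (sym (lookup∘tabulate _ j)) j∈fu)
    with lookup f i ≟ᶠ j
  ... | yes fi≡j = i , ∧-conicalˡ (lookup u i) true i∈u∧fi≡j , fi≡j
  ... | no _ = contradiction (∧-conicalʳ (lookup u i) false i∈u∧fi≡j) λ ()

  image-injective : ∀ (f : Map) → (∀ i j → lookup f i ≡ lookup f j → i ≡ j) →
    ∀ u u′ → image y f u ≡ image y f u′ → u ≡ u′
  image-injective f f-inj u u′ fu≡fu′ = begin
    u                        ≡⟨ tabulate∘lookup u ⟨
    tabulate (lookup u)      ≡⟨ tabulate-cong (λ i → ⇔→≡ (mk⇔ (⊆ {u} {u′} fu≡fu′ i) (⊆ {u′} {u} (sym fu≡fu′) i))) ⟩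
    tabulate (lookup u′)     ≡⟨ tabulate∘lookup u′ ⟩
    u′                       ∎
    where
    open ≡-Reasoning
    ⊆ : ∀ {v v′} → image y f v ≡ image y f v′ → ∀ i → i ∈ˢ v → i ∈ˢ v′
    ⊆ {v} {v′} fv≡fv′ i i∈v with i′ , i′∈v′ , fi′≡fi ← ∈-image⁻ f v′ (subst (lookup f i ∈ˢ_) fv≡fv′ (∈-image⁺ f v i∈v))
      rewrite f-inj i′ i fi′≡fi = i′∈v′

  coordinate : Map → Fin P → Coord y
  coordinate f a = cls a , image y f (𝒫 a)

  coordinates : Map → List (Coord y)
  coordinates f = map (coordinate f) (allFin P)

  coordinates-unique : ∀ {f} → f ∈ F → Unique (coordinates f)
  coordinates-unique {f} f∈F = Unique.map⁺ coordinate-injective (Unique.allFin⁺ P)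
    where
    coordinate-injective : ∀ {a a′} → coordinate f a ≡ coordinate f a′ → a ≡ a′
    coordinate-injective {a} {a′} eq =
      𝒫-inj a a′ (image-injective f (F-inj f f∈F) (𝒫 a) (𝒫 a′) (cong proj₂ eq))

  allSubsets-complete : ∀ k (v : Vec Bool k) → v ∈ allSubsets k
  allSubsets-complete zero Vec.[] = here refl
  allSubsets-complete (suc k) (b Vec.∷ v) =
    ∈-concatMap⁺ (λ v → (false Vec.∷ v) ∷ (true Vec.∷ v) ∷ [])
                 (Any.map (λ { refl → withHead b }) (allSubsets-complete k v))
    where
    withHead : ∀ b → (b Vec.∷ v) ∈ (false Vec.∷ v) ∷ (true Vec.∷ v) ∷ []
    withHead false = here refl
    withHead true = there (here refl)

  coordinates⊆coords : ∀ {f} → f ∈ F → ∀ {t} → t ∈ coordinates f → t ∈ coords y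
  coordinates⊆coords {f} f∈F t∈ with a , _ , refl ← ∈-map⁻ (coordinate f) t∈ =
    ∈-filter⁺ (λ s → inR y s ≟ᵇ true)
      (∈-concatMap⁺ (λ c → map (c ,_) (allSubsets n))
        (Any.map (λ { refl → ∈-map⁺ (cls a ,_) (allSubsets-complete n (image y f (𝒫 a))) }) (∈-allFin (cls a))))
      (any-true⁺ _ (∈-allFin a)
        (cong₂ _∧_ (dec-true (cls a ≟ᶠ cls a) refl)
                   (any-true⁺ _ f∈F (dec-true (≡-dec _≟ᵇ_ (image y f (𝒫 a)) (image y f (𝒫 a))) refl))))

  rangesMeet⁺ : ∀ (f g : Map) {i j} → lookup f i ≡ lookup g j → rangesMeet y f g ≡ true
  rangesMeet⁺ f g {i} {j} fi≡gj =
    any-true⁺ _ (∈-allFin i) (any-true⁺ _ (∈-allFin j) (dec-true (lookup f i ≟ᶠ lookup g j) fi≡gj))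

  rangesMeet⁻ : ∀ (f g : Map) → rangesMeet y f g ≡ true → ∃₂ λ i j → lookup f i ≡ lookup g j
  rangesMeet⁻ f g meet
    with i , meet-at-i ← any-true⁻ _ (allFin m) meet
    with j , fi≟gj ← any-true⁻ _ (allFin m) meet-at-i
    with lookup f i ≟ᶠ lookup g j
  ... | yes fi≡gj = i , j , fi≡gj

  rangesMeet-sym : ∀ (f g : Map) → rangesMeet y f g ≡ true → rangesMeet y g f ≡ true
  rangesMeet-sym f g meet with i , j , fi≡gj ← rangesMeet⁻ f g meet = rangesMeet⁺ g f (sym fi≡gj)

  sharedCoordinate⇒rangesMeet : ∀ (f g : Map) a → coordinate g a ∈ coordinates f → rangesMeet y f g ≡ true
  sharedCoordinate⇒rangesMeet f g a shared
    with a′ , _ , ga≡fa′ ← ∈-map⁻ (coordinate f) shared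
    with i , i∈a ← 𝒫-ne a
    with j , _ , fj≡gi ← ∈-image⁻ f (𝒫 a′) (subst (lookup g i ∈ˢ_) (cong proj₂ ga≡fa′) (∈-image⁺ g (𝒫 a) i∈a))
    = rangesMeet⁺ f g fj≡gi

  -- isolated y ω f unfolds to  isVertex y ω f ∧ all (noEdge ω f) F.
  noEdge : Outcome y → Map → Map → Bool
  noEdge ω f g = does (≡-dec _≟ᶠ_ g f) ∨ not (isVertex y ω g) ∨ not (rangesMeet y f g)

  noEdge-nonVertex : ∀ ω f {g} → isVertex y ω g ≡ false → noEdge ω f g ≡ true
  noEdge-nonVertex ω f {g} g∉V rewrite g∉V = ∨-zeroʳ _

  noEdge-disjoint : ∀ ω {f g} → rangesMeet y f g ≡ false → noEdge ω f g ≡ true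
  noEdge-disjoint ω {f} {g} f∩g≡∅ rewrite f∩g≡∅ | ∨-zeroʳ (not (isVertex y ω g)) = ∨-zeroʳ _

  noEdge-edge : ∀ ω {f g} → g ≢ f → isVertex y ω g ≡ true → rangesMeet y f g ≡ true → noEdge ω f g ≡ false
  noEdge-edge ω {f} {g} g≢f g∈V meet rewrite dec-false (≡-dec _≟ᶠ_ g f) g≢f | g∈V | meet = refl

  noEdge-cong : ∀ {ω ω′} f g → isVertex y ω g ≡ isVertex y ω′ g → noEdge ω f g ≡ noEdge ω′ f g
  noEdge-cong f g V≡V′ = cong (λ v → does (≡-dec _≟ᶠ_ g f) ∨ not v ∨ not (rangesMeet y f g)) V≡V′

  isVertex-cong : ∀ {ω ω′} → ω ≗ ω′ → ∀ g → isVertex y ω g ≡ isVertex y ω′ g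
  isVertex-cong ω≗ω′ g = all-cong (allFin P) (λ a _ → ω≗ω′ (coordinate g a))

  isolated-cong : ∀ {ω ω′} → ω ≗ ω′ → ∀ g → isolated y ω g ≡ isolated y ω′ g
  isolated-cong {ω} {ω′} ω≗ω′ g =
    cong₂ _∧_ (isVertex-cong ω≗ω′ g) (all-cong F (λ h _ → noEdge-cong {ω} {ω′} g h (isVertex-cong ω≗ω′ h)))

  Lt-cong : ∀ {ω ω′} → ω ≗ ω′ → Lt y ω ≡ Lt y ω′
  Lt-cong ω≗ω′ = count-cong F (λ g _ → isolated-cong ω≗ω′ g)

  Lt≤∣F∣ : ∀ ω → Lt y ω ℕ.≤ length F
  Lt≤∣F∣ ω = count-≤-length (isolated y ω) F

  module _ {f : Map} (f∈F : f ∈ F) {ω₀ ω₁ : Outcome y}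
           (ω₀⊑ω₁ : ∀ t → ω₀ t ≡ true → ω₁ t ≡ true)
           (agree-off-f : ∀ t → t ∉ coordinates f → ω₀ t ≡ ω₁ t)
           (f∉V₀ : isVertex y ω₀ f ≡ false)
           (f-isolated₁ : isolated y ω₁ f ≡ true) where

    isVertex-mono : ∀ g → isVertex y ω₀ g ≡ true → isVertex y ω₁ g ≡ true
    isVertex-mono g = all-mono (allFin P) (λ a → ω₀⊑ω₁ (coordinate g a))

    isVertex-agree-if-disjoint : ∀ g → rangesMeet y f g ≡ false → isVertex y ω₀ g ≡ isVertex y ω₁ g
    isVertex-agree-if-disjoint g f∩g≡∅ = all-cong (allFin P) (λ a _ → agree-off-f (coordinate g a)
      (λ shared → contradiction (trans (sym (sharedCoordinate⇒rangesMeet f g a shared)) f∩g≡∅) λ ()))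

    vertex-disjoint-from-f : ∀ g → g ∈ F → g ≢ f → isVertex y ω₁ g ≡ true → rangesMeet y f g ≡ false
    vertex-disjoint-from-f g g∈F g≢f g∈V₁ = ¬-not λ meet → contradiction
      (trans (sym (all-true⁻ (noEdge ω₁ f) (∧-conicalʳ _ _ f-isolated₁) g∈F)) (noEdge-edge ω₁ g≢f g∈V₁ meet)) λ ()

    isVertex-agree-off-f : ∀ g → g ∈ F → g ≢ f → isVertex y ω₀ g ≡ isVertex y ω₁ g
    isVertex-agree-off-f g g∈F g≢f with isVertex y ω₁ g in g∈V₁
    ... | true  = trans (isVertex-agree-if-disjoint g (vertex-disjoint-from-f g g∈F g≢f g∈V₁)) g∈V₁
    ... | false = ¬-not (λ g∈V₀ → contradiction (trans (sym (isVertex-mono g g∈V₀)) g∈V₁) λ ())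

    isolated-agree-off-f : ∀ g → g ∈ F → g ≢ f → isolated y ω₀ g ≡ isolated y ω₁ g
    isolated-agree-off-f g g∈F g≢f with isVertex y ω₁ g in g∈V₁
    ... | false = cong (_∧ all (noEdge ω₀ g) F) (trans (isVertex-agree-off-f g g∈F g≢f) g∈V₁)
    ... | true  = cong₂ _∧_ (trans (isVertex-agree-off-f g g∈F g≢f) g∈V₁) (all-cong F noEdge-agrees)
      where
      noEdge-agrees : ∀ h → h ∈ F → noEdge ω₀ g h ≡ noEdge ω₁ g h
      noEdge-agrees h h∈F with ≡-dec _≟ᶠ_ h f
      ... | yes refl = trans (noEdge-nonVertex ω₀ g {f} f∉V₀)
          (sym (noEdge-disjoint ω₁ {g} {f} (¬-not λ g∩f → contradiction
            (trans (sym (rangesMeet-sym g f g∩f)) (vertex-disjoint-from-f g g∈F g≢f g∈V₁)) λ ())))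
      ... | no h≢f = noEdge-cong {ω₀} {ω₁} g h (isVertex-agree-off-f h h∈F h≢f)

    Lt-remove-isolated : Lt y ω₁ ≡ suc (Lt y ω₀)
    Lt-remove-isolated = count-toggle F F-uniq f∈F isolated-agree-off-f (cong (_∧ all (noEdge ω₀ f) F) f∉V₀) f-isolated₁

  ≟ᶜ-refl : ∀ s → (_≟ᶜ_ y s s) ≡ true
  ≟ᶜ-refl (c , v) rewrite dec-true (c ≟ᶠ c) refl | dec-true (≡-dec _≟ᵇ_ v v) refl = refl

  ≟ᶜ-sound : ∀ {s t} → (_≟ᶜ_ y s t) ≡ true → s ≡ t
  ≟ᶜ-sound {c , v} {c′ , v′} eq with c ≟ᶠ c′ | ≡-dec _≟ᵇ_ v v′
  ... | yes refl | yes refl = refl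

  open Bernoulli (_≟ᶜ_ y) ≟ᶜ-refl ≟ᶜ-sound (prob ∘ proj₁) (prob-lo ∘ proj₁) (prob-hi ∘ proj₁)

  PrOver-as-𝔼 : ∀ ss ω E → PrOver y ss ω E ≡ 𝔼 ss ω (𝟙 ∘ E)
  PrOver-as-𝔼 [] ω E with E ω
  ... | true  = refl
  ... | false = refl
  PrOver-as-𝔼 (s ∷ ss) ω E = cong₂ (mix s) (PrOver-as-𝔼 ss _ E) (PrOver-as-𝔼 ss _ E)

  Lt-clear-coordinates : Fin P → ∀ {f} → f ∈ F → ∀ ω → isolated y (setAll (coordinates f) true ω) f ≡ true →
    Lt y (setAll (coordinates f) true ω) ≡ suc (Lt y (setAll (coordinates f) false ω))
  Lt-clear-coordinates a₀ {f} f∈F ω = Lt-remove-isolated f∈F (setAll-false⊑true S ω)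
    (λ t t∉S → trans (setAll-∉ S false ω t∉S) (sym (setAll-∉ S true ω t∉S))) f∉V₀
    where
    S = coordinates f
    f∉V₀ : isVertex y (setAll S false ω) f ≡ false
    f∉V₀ = ¬-not λ f∈V₀ → contradiction
      (trans (sym (all-true⁻ _ f∈V₀ (∈-allFin a₀))) (setAll-∈ S false ω (∈-map⁺ (coordinate f) (∈-allFin a₀)))) λ ()

  [Lt≡_] : ℕ → Outcome y → ℚ
  [Lt≡ k ] ω = 𝟙 (does (Lt y ω ℕ.≟ k))

  [_isolated∧Lt≡_] : Map → ℕ → Outcome y → ℚ
  [ f isolated∧Lt≡ k ] ω = 𝟙 (isolated y ω f) * [Lt≡ k ] ω

  [Lt≡]-extensional : ∀ k → Extensional [Lt≡ k ]
  [Lt≡]-extensional k ω≗ω′ = cong (λ L → 𝟙 (does (L ℕ.≟ k))) (Lt-cong ω≗ω′)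

  [isolated∧Lt≡]-extensional : ∀ f k → Extensional [ f isolated∧Lt≡ k ]
  [isolated∧Lt≡]-extensional f k ω≗ω′ = cong₂ _*_ (cong 𝟙 (isolated-cong ω≗ω′ f)) ([Lt≡]-extensional k ω≗ω′)

  [isolated∧Lt≡]-on-vertices : ∀ f k ω → [ f isolated∧Lt≡ k ] ω ≡ 𝟙 (isVertex y ω f) * [ f isolated∧Lt≡ k ] ω
  [isolated∧Lt≡]-on-vertices f k ω with isVertex y ω f
  ... | true  = sym (ℚ.*-identityˡ _)
  ... | false = trans (ℚ.*-zeroˡ ([Lt≡ k ] ω)) (sym (ℚ.*-zeroˡ (0ℚ * [Lt≡ k ] ω)))

  ∑-[isolated∧Lt≡] : ∀ k ω → ∑ (λ f → [ f isolated∧Lt≡ k ] ω) F ≡ ℕ→ℚ k * [Lt≡ k ] ω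
  ∑-[isolated∧Lt≡] k ω = begin
    ∑ (λ f → 𝟙 (isolated y ω f) * [Lt≡ k ] ω) F   ≡⟨ ∑-*ʳ ([Lt≡ k ] ω) (𝟙 ∘ isolated y ω) F ⟩
    ∑ (𝟙 ∘ isolated y ω) F * [Lt≡ k ] ω            ≡⟨ cong (_* [Lt≡ k ] ω) (count-as-∑ (isolated y ω) F) ⟨
    ℕ→ℚ (Lt y ω) * [Lt≡ k ] ω                      ≡⟨ onLevel (Lt y ω ℕ.≟ k) ⟩
    ℕ→ℚ k * [Lt≡ k ] ω                             ∎
    where
    open ≡-Reasoning
    onLevel : (d : Dec (Lt y ω ≡ k)) → ℕ→ℚ (Lt y ω) * 𝟙 (does d) ≡ ℕ→ℚ k * 𝟙 (does d)
    onLevel (yes Lt≡k) = cong (λ L → ℕ→ℚ L * 1ℚ) Lt≡k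
    onLevel (no _) = trans (ℚ.*-zeroʳ (ℕ→ℚ (Lt y ω))) (sym (ℚ.*-zeroʳ (ℕ→ℚ k)))

  ∏-bern-coordinates-true : ∀ f → ∏ (λ s → bern s true) (coordinates f) ≡ qAll y
  ∏-bern-coordinates-true f = foldr-map _ (coordinate f) 1ℚ (allFin P)

  ∏-bern-coordinates-false : ∀ f → ∏ (λ s → bern s false) (coordinates f) ≡ qEmpty y
  ∏-bern-coordinates-false f = foldr-map _ (coordinate f) 1ℚ (allFin P)

  constantOn-coordinates : ∀ f ω → constantOn (coordinates f) true ω ≡ isVertex y ω f
  constantOn-coordinates f ω = cong and (sym (map-∘ (allFin P)))

  qAll-nonNeg : 0ℚ ≤ qAll y
  qAll-nonNeg = ∏-nonNeg (allFin P) (λ a → prob-lo (cls a))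

  qEmpty-nonNeg : 0ℚ ≤ qEmpty y
  qEmpty-nonNeg = ∏-nonNeg (allFin P) (λ a → 0≤1-p (prob-hi (cls a)))

  0<qEmpty : .{{NonZero (qEmpty y)}} → 0ℚ < qEmpty y
  0<qEmpty = ℚ.positive⁻¹ (qEmpty y) {{ℚ.nonNeg∧nonZero⇒pos (qEmpty y) {{nonNegative qEmpty-nonNeg}}}}

  [isolated∧Lt≡suc]≤[Lt≡]-cleared : Fin P → ∀ {f} → f ∈ F → ∀ k ω →
    [ f isolated∧Lt≡ suc k ] (setAll (coordinates f) true ω) ≤ [Lt≡ k ] (setAll (coordinates f) false ω)
  [isolated∧Lt≡suc]≤[Lt≡]-cleared a₀ {f} f∈F k ω with isolated y (setAll (coordinates f) true ω) f in f-isolated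
  ... | false = subst (_≤ [Lt≡ k ] ω₀) (sym (ℚ.*-zeroˡ ([Lt≡ suc k ] ω₁))) (𝟙-nonNeg (does (Lt y ω₀ ℕ.≟ k)))
    where
    ω₀ = setAll (coordinates f) false ω
    ω₁ = setAll (coordinates f) true ω
  ... | true  = ℚ.≤-reflexive (trans (ℚ.*-identityˡ ([Lt≡ suc k ] (setAll (coordinates f) true ω)))
                  (cong (λ L → 𝟙 (does (L ℕ.≟ suc k))) (Lt-clear-coordinates a₀ f∈F ω f-isolated)))

  𝔼[isolated∧Lt≡suc]-bound : Fin P → ∀ {f} → f ∈ F → ∀ k ω →
    qEmpty y * 𝔼 (coords y) ω [ f isolated∧Lt≡ suc k ] ≤ qAll y * 𝔼 (coords y) ω [Lt≡ k ]
  𝔼[isolated∧Lt≡suc]-bound a₀ {f} f∈F k ω = begin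
    qEmpty y * 𝔼 Ξ ω X
      ≡⟨ cong (qEmpty y *_) (𝔼-cong Ξ ω (λ ω → trans ([isolated∧Lt≡]-on-vertices f (suc k) ω)
                                               (cong (λ v → 𝟙 v * X ω) (sym (constantOn-coordinates f ω))))) ⟩
    qEmpty y * 𝔼 Ξ ω (λ ω → 𝟙 (constantOn S true ω) * X ω)
      ≡⟨ cong (qEmpty y *_) (trans (factor true X ([isolated∧Lt≡]-extensional f (suc k)))
                                   (cong (_* 𝔼 Ξ ω (X ∘ setAll S true)) (∏-bern-coordinates-true f))) ⟩
    qEmpty y * (qAll y * 𝔼 Ξ ω (X ∘ setAll S true))
      ≤⟨ *-monoˡ-≤-0≤ qEmpty-nonNeg
           (*-monoˡ-≤-0≤ qAll-nonNeg (𝔼-mono-≤ Ξ ω ([isolated∧Lt≡suc]≤[Lt≡]-cleared a₀ f∈F k))) ⟩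
    qEmpty y * (qAll y * 𝔼 Ξ ω (Y ∘ setAll S false))
      ≡⟨ ℚ.*-assoc (qEmpty y) (qAll y) _ ⟨
    qEmpty y * qAll y * 𝔼 Ξ ω (Y ∘ setAll S false)
      ≡⟨ cong (_* 𝔼 Ξ ω (Y ∘ setAll S false)) (ℚ.*-comm (qEmpty y) (qAll y)) ⟩
    qAll y * qEmpty y * 𝔼 Ξ ω (Y ∘ setAll S false)
      ≡⟨ ℚ.*-assoc (qAll y) (qEmpty y) _ ⟩
    qAll y * (qEmpty y * 𝔼 Ξ ω (Y ∘ setAll S false))
      ≡⟨ cong (qAll y *_) (trans (factor false Y ([Lt≡]-extensional k))
                                 (cong (_* 𝔼 Ξ ω (Y ∘ setAll S false)) (∏-bern-coordinates-false f))) ⟨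
    qAll y * 𝔼 Ξ ω (λ ω → 𝟙 (constantOn S false ω) * Y ω)
      ≤⟨ *-monoˡ-≤-0≤ qAll-nonNeg (𝔼-mono-≤ Ξ ω (λ ω → 𝟙-*-≤ (constantOn S false ω) (𝟙-nonNeg (does (Lt y ω ℕ.≟ k))))) ⟩
    qAll y * 𝔼 Ξ ω Y ∎
    where
    open ℚ.≤-Reasoning
    Ξ = coords y
    S = coordinates f
    X = [ f isolated∧Lt≡ suc k ]
    Y = [Lt≡ k ]
    factor : ∀ b Z → Extensional Z →
      𝔼 Ξ ω (λ ω → 𝟙 (constantOn S b ω) * Z ω) ≡ ∏ (λ s → bern s b) S * 𝔼 Ξ ω (Z ∘ setAll S b)
    factor b Z = 𝔼-factor Ξ ω S b Z (coordinates⊆coords f∈F) (coordinates-unique f∈F)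

  ∅ : Outcome y
  ∅ _ = false

  Pr[Lt≡_] : ℕ → ℚ
  Pr[Lt≡ k ] = Pr y (λ ω → does (Lt y ω ℕ.≟ k))

  Pr[_<Lt] : ℕ → ℚ
  Pr[ k <Lt] = Pr y (λ ω → does (k ℕ.<? Lt y ω))

  Pr-nonNeg : ∀ E → 0ℚ ≤ Pr y E
  Pr-nonNeg E = subst (0ℚ ≤_) (sym (PrOver-as-𝔼 (coords y) ∅ E)) (𝔼-nonNeg (coords y) ∅ (𝟙-nonNeg ∘ E))

  Pr[Lt≡]-recurrence : Fin P → ∀ k →
    qEmpty y * (ℕ→ℚ (suc k) * Pr[Lt≡ suc k ]) ≤ ℕ→ℚ (length F) * (qAll y * Pr[Lt≡ k ])
  Pr[Lt≡]-recurrence a₀ k = begin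
    qEmpty y * (ℕ→ℚ (suc k) * Pr[Lt≡ suc k ])
      ≡⟨ cong (λ p → qEmpty y * (ℕ→ℚ (suc k) * p)) (PrOver-as-𝔼 Ξ ∅ _) ⟩
    qEmpty y * (ℕ→ℚ (suc k) * 𝔼 Ξ ∅ [Lt≡ suc k ])
      ≡⟨ cong (qEmpty y *_) (𝔼-*ˡ Ξ ∅ (ℕ→ℚ (suc k)) [Lt≡ suc k ]) ⟨
    qEmpty y * 𝔼 Ξ ∅ (λ ω → ℕ→ℚ (suc k) * [Lt≡ suc k ] ω)
      ≡⟨ cong (qEmpty y *_) (𝔼-cong Ξ ∅ (∑-[isolated∧Lt≡] (suc k))) ⟨
    qEmpty y * 𝔼 Ξ ∅ (λ ω → ∑ (λ f → [ f isolated∧Lt≡ suc k ] ω) F)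
      ≡⟨ cong (qEmpty y *_) (𝔼-∑ Ξ ∅ (λ f → [ f isolated∧Lt≡ suc k ]) F) ⟩
    qEmpty y * ∑ (λ f → 𝔼 Ξ ∅ [ f isolated∧Lt≡ suc k ]) F
      ≡⟨ ∑-*ˡ (qEmpty y) (λ f → 𝔼 Ξ ∅ [ f isolated∧Lt≡ suc k ]) F ⟨
    ∑ (λ f → qEmpty y * 𝔼 Ξ ∅ [ f isolated∧Lt≡ suc k ]) F
      ≤⟨ ∑-mono-≤ F (λ f f∈F → 𝔼[isolated∧Lt≡suc]-bound a₀ f∈F k ∅) ⟩
    ∑ (λ _ → qAll y * 𝔼 Ξ ∅ [Lt≡ k ]) F
      ≡⟨ ∑-const (qAll y * 𝔼 Ξ ∅ [Lt≡ k ]) F ⟩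
    ℕ→ℚ (length F) * (qAll y * 𝔼 Ξ ∅ [Lt≡ k ])
      ≡⟨ cong (λ p → ℕ→ℚ (length F) * (qAll y * p)) (PrOver-as-𝔼 Ξ ∅ _) ⟨
    ℕ→ℚ (length F) * (qAll y * Pr[Lt≡ k ]) ∎
    where
    open ℚ.≤-Reasoning
    Ξ = coords y

  𝟙-<-split : ∀ k L → 𝟙 (does (k ℕ.<? L)) ≡ 𝟙 (does (L ℕ.≟ suc k)) + 𝟙 (does (suc k ℕ.<? L))
  𝟙-<-split k L with L ℕ.≟ suc k | k ℕ.<? L
  ... | yes refl | _
    rewrite dec-true (k ℕ.<? suc k) (ℕ.n<1+n k) | dec-true (suc k ℕ.≟ suc k) refl
          | dec-false (suc k ℕ.<? suc k) (ℕ.<-irrefl refl) = sym (ℚ.+-identityʳ 1ℚ)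
  ... | no L≢1+k | yes k<L
    rewrite dec-false (L ℕ.≟ suc k) L≢1+k | dec-true (k ℕ.<? L) k<L
          | dec-true (suc k ℕ.<? L) (ℕ.≤∧≢⇒< k<L (L≢1+k ∘ sym)) = sym (ℚ.+-identityˡ 1ℚ)
  ... | no L≢1+k | no k≮L
    rewrite dec-false (L ℕ.≟ suc k) L≢1+k | dec-false (k ℕ.<? L) k≮L
          | dec-false (suc k ℕ.<? L) (k≮L ∘ ℕ.<-trans (ℕ.n<1+n k)) = sym (ℚ.+-identityʳ 0ℚ)

  Pr[<Lt]-split : ∀ k → Pr[ k <Lt] ≡ Pr[Lt≡ suc k ] + Pr[ suc k <Lt]
  Pr[<Lt]-split k = begin
    Pr[ k <Lt]
      ≡⟨ PrOver-as-𝔼 Ξ ∅ _ ⟩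
    𝔼 Ξ ∅ (λ ω → 𝟙 (does (k ℕ.<? Lt y ω)))
      ≡⟨ 𝔼-cong Ξ ∅ (𝟙-<-split k ∘ Lt y) ⟩
    𝔼 Ξ ∅ (λ ω → [Lt≡ suc k ] ω + 𝟙 (does (suc k ℕ.<? Lt y ω)))
      ≡⟨ 𝔼-+ Ξ ∅ _ _ ⟩
    𝔼 Ξ ∅ [Lt≡ suc k ] + 𝔼 Ξ ∅ (λ ω → 𝟙 (does (suc k ℕ.<? Lt y ω)))
      ≡⟨ cong₂ _+_ (PrOver-as-𝔼 Ξ ∅ _) (PrOver-as-𝔼 Ξ ∅ _) ⟨
    Pr[Lt≡ suc k ] + Pr[ suc k <Lt] ∎
    where
    open ≡-Reasoning
    Ξ = coords y

  Pr[<Lt]-vanishes : ∀ k → length F ℕ.≤ k → Pr[ k <Lt] ≡ 0ℚ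
  Pr[<Lt]-vanishes k ∣F∣≤k = trans (PrOver-as-𝔼 (coords y) ∅ _)
    (trans (𝔼-cong (coords y) ∅ (λ ω → cong 𝟙 (dec-false (k ℕ.<? Lt y ω)
                                            (λ k<Lt → ℕ.<⇒≱ k<Lt (ℕ.≤-trans (Lt≤∣F∣ ω) ∣F∣≤k)))))
           (𝔼-const (coords y) ∅ 0ℚ))

  ∣F∣≤-of-P≡0 : P ≡ 0 → ∀ {l} → ℕ→ℚ 2 * qAll y * ℕ→ℚ (length F) ≤ ℕ→ℚ l * qEmpty y → length F ℕ.≤ l
  ∣F∣≤-of-P≡0 P≡0 {l} bound = ℕ→ℚ-cancel-≤ (begin
    ℕ→ℚ (length F)                 ≤⟨ ≤-double (ℕ→ℚ-nonNeg (length F)) ⟩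
    ℕ→ℚ 2 * ℕ→ℚ (length F)         ≡⟨ cong (λ q → ℕ→ℚ 2 * q * ℕ→ℚ (length F)) (∏-allFin-zero (p y) P≡0) ⟨
    ℕ→ℚ 2 * qAll y * ℕ→ℚ (length F) ≤⟨ bound ⟩
    ℕ→ℚ l * qEmpty y               ≡⟨ cong (ℕ→ℚ l *_) (∏-allFin-zero (λ a → 1ℚ - p y a) P≡0) ⟩
    ℕ→ℚ l * 1ℚ                     ≡⟨ ℚ.*-identityʳ (ℕ→ℚ l) ⟩
    ℕ→ℚ l                          ∎)
    where open ℚ.≤-Reasoning

mainTheorem12 : (y : System) → WeaklySeparative y → (L* : ℕ) →
    {{_ : NonZero (qEmpty y)}} →
    (ℕ→ℚ 2 * qAll y * ℕ→ℚ (length (System.F y))) ÷ qEmpty y ≤ ℕ→ℚ L* →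
    Pr y (λ ω → does (L* ℕ.<? Lt y ω)) ≤ Pr y (λ ω → does (Lt y ω ℕ.≟ L*))
mainTheorem12 y _ L* H = [ noCoordinates , someCoordinate ]′ (zero⊎Fin P)
  where
  open System y
  open RandomGraph y
  2qA∣F∣≤L*qE : ℕ→ℚ 2 * qAll y * ℕ→ℚ (length F) ≤ ℕ→ℚ L* * qEmpty y
  2qA∣F∣≤L*qE = ÷-≤⇒≤-* qEmpty-nonNeg H
  noCoordinates : P ≡ 0 → Pr[ L* <Lt] ≤ Pr[Lt≡ L* ]
  noCoordinates P≡0 =
    subst (_≤ Pr[Lt≡ L* ]) (sym (Pr[<Lt]-vanishes L* (∣F∣≤-of-P≡0 P≡0 2qA∣F∣≤L*qE))) (Pr-nonNeg _)
  someCoordinate : Fin P → Pr[ L* <Lt] ≤ Pr[Lt≡ L* ]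
  someCoordinate a₀ =
    tail≤head Pr[Lt≡_] Pr[_<Lt] L* (length F) Pr[<Lt]-split Pr[<Lt]-vanishes (λ _ → Pr-nonNeg _) halving
    where
    halving : ∀ k → L* ℕ.≤ k → Pr[Lt≡ suc k ] + Pr[Lt≡ suc k ] ≤ Pr[Lt≡ k ]
    halving k L*≤k = halving-of-recurrence {a = qAll y} {n = ℕ→ℚ (length F)} 0<qEmpty (0<ℕ→ℚ-suc k) (Pr-nonNeg _)
      (Pr[Lt≡]-recurrence a₀ k) 2qA∣F∣≤L*qE (ℕ→ℚ-mono-≤ (ℕ.m≤n⇒m≤1+n L*≤k))
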